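{- For the directed path $P_n=(v_1,v_2,\dots,v_n)$ (arcs $v_iv_{i+1}$), $n\ge 1$, $\gamma_{iso}(P_n)=\lceil 2n/3\rceil$.
   Context: For a digraph $D=(V,A)$, $N^+(v)=\{w: vw\in A\}$. $S\subseteq V$ is out-dominating if every $v\in V\setminus S$ has an in-neighbor in $S$. $S$ is an in-secure out-dominating set (ISODS) if $S$ is out-dominating and for every $v\in V\setminus S$ there is $u\in N^+(v)\cap S$ such that $(S\setminus\{u\})\cup\{v\}$ is out-dominating; $\gamma_{iso}(D)$ is the minimum size of an ISODS. -}

module Defs where

open import Data.Nat using (ℕ; suc; _≤_; _+_; _*_; _/_)
open import Data.Fin using (Fin; toℕ)
open import Data.Fin.Subset using (Subset; _∈_; _∉_; ∣_∣; _∪_; ⁅_⁆; _─_)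
open import Data.Product using (Σ; _×_; ∃; ∃-syntax; _,_)
open import Relation.Binary.PropositionalEquality using (_≡_)

record Digraph (n : ℕ) : Set₁ where
  field
    Arc : Fin n → Fin n → Set

open Digraph public

OutDominating : ∀ {n} → Digraph n → Subset n → Set
OutDominating D S = ∀ v → v ∉ S → ∃[ u ] (u ∈ S × Arc D u v)

swap : ∀ {n} → Subset n → Fin n → Fin n → Subset n
swap S u v = (S ─ ⁅ u ⁆) ∪ ⁅ v ⁆

ISODS : ∀ {n} → Digraph n → Subset n → Set
ISODS D S =
  OutDominating D S ×
  (∀ v → v ∉ S → ∃[ u ] (Arc D v u × u ∈ S × OutDominating D (swap S u v)))

IsγIso : ∀ {n} → Digraph n → ℕ → Set
IsγIso D k =
  (∃[ S ] (ISODS D S × ∣ S ∣ ≡ k)) × (∀ S → ISODS D S → k ≤ ∣ S ∣)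

-- Directed path P_n = (v_1,…,v_n): vertex i (0-indexed) has arc to i+1.
PathDigraph : (n : ℕ) → Digraph n
PathDigraph n = record { Arc = λ u w → suc (toℕ u) ≡ toℕ w }

-- ⌈2n/3⌉ = ⌊(2n+2)/3⌋
ceil2n/3 : ℕ → ℕ
ceil2n/3 n = (2 * n + 2) / 3

-- Read a subset S of the path as a Boolean word. S is out-dominating iff every
-- non-member is preceded by a member, and it is then in-secure iff moreover every
-- non-member v is followed by two members, the first one existing: swapping v
-- with its out-neighbour v+1 leaves v+2 without in-neighbour unless v+2 ∈ S.
-- These words are exactly the concatenations of blocks ● and ●○●, each with at
-- least two thirds of its letters in S, so 2n ≤ 3∣S∣; and (●○●)*(ε | ● | ●●)
-- attains ⌈2n/3⌉.
module Submission where

open import Defs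
open import Data.Nat using (ℕ; zero; suc; _+_; _*_; _≤_; _<_; _/_; z≤n; s≤s)
open import Data.Nat.Properties using (suc-injective; 1+n≢n; m+1+n≢n; ≤-pred; +-monoˡ-≤; +-monoʳ-≤; +-mono-≤; *-distribˡ-+; +-comm; ≤-reflexive; n≤1+n; module ≤-Reasoning)
open import Data.Nat.Divisibility using (divides-refl)
open import Data.Nat.DivMod using (m<n*o⇒m/o<n; +-distrib-/-∣ʳ)
open import Data.Nat.Tactic.RingSolver using (solve-∀)
open import Data.Bool using (Bool; true; false)
open import Data.Fin using (Fin; toℕ; fromℕ<; inject₁; _≟_) renaming (zero to fzero; suc to fsuc)
open import Data.Fin.Properties using (toℕ-fromℕ<; toℕ-injective; toℕ<n; toℕ-inject₁)
open import Data.Fin.Subset using (Subset; _∈_; _∉_; ∣_∣; _─_; ⁅_⁆)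
open import Data.Fin.Subset.Properties using (_∈?_; x∈⁅x⁆; x∈⁅y⁆⇒x≡y; x∈p∪q⁻; x∈p∪q⁺)
open import Data.Vec using ([]; _∷_; here; there)
open import Data.Product using (_×_; ∃-syntax; _,_; proj₁; proj₂)
open import Data.Sum using (_⊎_; inj₁; inj₂)
open import Function using (_∘_)
open import Relation.Nullary using (yes; no; contradiction)
open import Relation.Binary.PropositionalEquality

private variable
  n : ℕ

x∈p─q⁻ : ∀ (p q : Subset n) {x} → x ∈ p ─ q → x ∈ p × x ∉ q
x∈p─q⁻ (true ∷ p) (false ∷ q) here = here , λ ()
x∈p─q⁻ (false ∷ p) (false ∷ q) {fzero} ()
x∈p─q⁻ (_ ∷ p) (true ∷ q) {fzero} ()
x∈p─q⁻ (_ ∷ p) (_ ∷ q) (there x∈) with x∈p─q⁻ p q x∈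
... | x∈p , x∉q = there x∈p , λ { (there x∈q) → x∉q x∈q }

x∈p─q⁺ : ∀ (p q : Subset n) {x} → x ∈ p → x ∉ q → x ∈ p ─ q
x∈p─q⁺ (true ∷ p) (false ∷ q) here x∉q = here
x∈p─q⁺ (true ∷ p) (true ∷ q) here x∉q = contradiction here x∉q
x∈p─q⁺ (_ ∷ p) (_ ∷ q) (there x∈p) x∉q = there (x∈p─q⁺ p q x∈p (x∉q ∘ there))

module _ {S : Subset n} {u v : Fin n} where

  v∈swap : v ∈ swap S u v
  v∈swap = x∈p∪q⁺ (inj₂ (x∈⁅x⁆ v))

  x∈swap⁺ : ∀ {x} → x ∈ S → x ≢ u → x ∈ swap S u v
  x∈swap⁺ x∈S x≢u = x∈p∪q⁺ (inj₁ (x∈p─q⁺ S ⁅ u ⁆ x∈S (x≢u ∘ x∈⁅y⁆⇒x≡y u)))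

  x∈swap⁻ : ∀ {x} → x ∈ swap S u v → x ≡ v ⊎ (x ∈ S × x ≢ u)
  x∈swap⁻ x∈ with x∈p∪q⁻ (S ─ ⁅ u ⁆) ⁅ v ⁆ x∈
  ... | inj₂ x∈⁅v⁆ = inj₁ (x∈⁅y⁆⇒x≡y v x∈⁅v⁆)
  ... | inj₁ x∈S─u with x∈p─q⁻ S ⁅ u ⁆ x∈S─u
  ... | x∈S , x∉⁅u⁆ = inj₂ (x∈S , λ { refl → x∉⁅u⁆ (x∈⁅x⁆ u) })

  x∉swap⁺ : ∀ {x} → x ∉ S → x ≢ v → x ∉ swap S u v
  x∉swap⁺ x∉S x≢v x∈ with x∈swap⁻ x∈
  ... | inj₁ x≡v = x≢v x≡v
  ... | inj₂ (x∈S , _) = x∉S x∈S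

  x∉swap⁻ : ∀ {x} → x ∉ swap S u v → x ≢ u → x ∉ S
  x∉swap⁻ x∉swap x≢u x∈S = x∉swap (x∈swap⁺ x∈S x≢u)

module _ (D : Digraph n) {S : Subset n} {u v : Fin n} where

  swap-outDominating : OutDominating D S → Arc D v u → (∀ x → Arc D u x → x ∈ S) →
                       OutDominating D (swap S u v)
  swap-outDominating dom vu u⁺⊆S x x∉swap with x ≟ u
  ... | yes refl = v , v∈swap , vu
  ... | no x≢u with dom x (x∉swap⁻ x∉swap x≢u)
  ...   | y , y∈S , yx with y ≟ u
  ...     | yes refl = contradiction (u⁺⊆S x yx) (x∉swap⁻ x∉swap x≢u)
  ...     | no y≢u = y , x∈swap⁺ y∈S y≢u , yx

  swap-outDominating⁻ : OutDominating D (swap S u v) → u ≢ v →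
                        ∀ {x} → x ≢ v → (∀ y → Arc D y x → y ≡ u) → x ∈ S
  swap-outDominating⁻ dom u≢v {x} x≢v x⁻≡u with x ∈? S
  ... | yes x∈S = x∈S
  ... | no x∉S with dom x (x∉swap⁺ x∉S x≢v)
  ...   | y , y∈swap , yx with x∈swap⁻ y∈swap
  ...     | inj₁ y≡v = contradiction (trans (sym (x⁻≡u y yx)) y≡v) u≢v
  ...     | inj₂ (_ , y≢u) = contradiction (x⁻≡u y yx) y≢u

-- Indices beyond the end of the word count as members.
χ : Subset n → ℕ → Bool
χ [] _ = true
χ (b ∷ S) zero = b
χ (b ∷ S) (suc i) = χ S i

∈⇒χ≡true : ∀ {S : Subset n} {i} → i ∈ S → χ S (toℕ i) ≡ true
∈⇒χ≡true here = refl
∈⇒χ≡true (there i∈S) = ∈⇒χ≡true i∈S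

χ≡true⇒∈ : ∀ (S : Subset n) i → χ S (toℕ i) ≡ true → i ∈ S
χ≡true⇒∈ (true ∷ S) fzero _ = here
χ≡true⇒∈ (_ ∷ S) (fsuc i) χi = there (χ≡true⇒∈ S i χi)

∉⇒χ≡false : ∀ (S : Subset n) {i} → i ∉ S → χ S (toℕ i) ≡ false
∉⇒χ≡false S {i} i∉S with χ S (toℕ i) in χi
... | true = contradiction (χ≡true⇒∈ S i χi) i∉S
... | false = refl

χ≡false⇒∉ : ∀ (S : Subset n) v → χ S v ≡ false → ∃[ i ] toℕ i ≡ v × i ∉ S
χ≡false⇒∉ (false ∷ S) zero _ = fzero , refl , λ ()
χ≡false⇒∉ (_ ∷ S) (suc v) χv with χ≡false⇒∉ S v χv
... | i , refl , i∉S = fsuc i , refl , λ { (there i∈S) → i∉S i∈S }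

Preceded : (ℕ → Bool) → Set
Preceded f = f 0 ≡ true × (∀ w → f (suc w) ≡ false → f w ≡ true)

Followed : (ℕ → Bool) → ℕ → Set
Followed f n = ∀ v → f v ≡ false → suc v < n × f (suc v) ≡ true × f (suc (suc v)) ≡ true

module _ {a b : Fin n} where

  path-arc⇒≢ : Arc (PathDigraph n) a b → a ≢ b
  path-arc⇒≢ ab refl = 1+n≢n ab

  path-inNeighbour-unique : ∀ {x} → Arc (PathDigraph n) a x → Arc (PathDigraph n) b x → a ≡ b
  path-inNeighbour-unique ax bx = toℕ-injective (suc-injective (trans ax (sym bx)))

module _ {S : Subset n} where

  outDominating⇒preceded : OutDominating (PathDigraph n) S → Preceded (χ S)
  outDominating⇒preceded dom = first , rest
    where
    predecessor : ∀ v → χ S v ≡ false → ∃[ w ] suc w ≡ v × χ S w ≡ true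
    predecessor v χv with χ≡false⇒∉ S v χv
    ... | i , refl , i∉S with dom i i∉S
    ... | u , u∈S , ui = toℕ u , ui , ∈⇒χ≡true u∈S

    first : χ S 0 ≡ true
    first with χ S 0 in χ0
    ... | true = refl
    ... | false with predecessor 0 χ0
    ... | _ , () , _

    rest : ∀ w → χ S (suc w) ≡ false → χ S w ≡ true
    rest w χw⁺ with predecessor (suc w) χw⁺
    ... | _ , refl , χw = χw

  preceded⇒outDominating : Preceded (χ S) → OutDominating (PathDigraph n) S
  preceded⇒outDominating (first , _) fzero v∉S = contradiction (χ≡true⇒∈ S fzero first) v∉S
  preceded⇒outDominating (_ , rest) (fsuc v) v∉S =
    inject₁ v , χ≡true⇒∈ S (inject₁ v) χv , cong suc (toℕ-inject₁ v)
    where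
    χv : χ S (toℕ (inject₁ v)) ≡ true
    χv = subst (λ k → χ S k ≡ true) (sym (toℕ-inject₁ v)) (rest (toℕ v) (∉⇒χ≡false S v∉S))

  isods⇒followed : ISODS (PathDigraph n) S → Followed (χ S) n
  isods⇒followed (_ , secure) v χv with χ≡false⇒∉ S v χv
  ... | i , refl , i∉S with secure i i∉S
  ... | u , iu , u∈S , dom′ =
    subst (_< n) (sym iu) (toℕ<n u) , subst (λ k → χ S k ≡ true) (sym iu) (∈⇒χ≡true u∈S) , secondMember
    where
    secondMember : χ S (suc (suc (toℕ i))) ≡ true
    secondMember with χ S (suc (suc (toℕ i))) in χj
    ... | true = refl
    ... | false with χ≡false⇒∉ S _ χj
    ... | j , j≡ , j∉S = contradiction j∈S j∉S
      where
      uj : Arc (PathDigraph n) u j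
      uj = trans (cong suc (sym iu)) (sym j≡)
      j∈S : j ∈ S
      j∈S = swap-outDominating⁻ (PathDigraph n) dom′ (≢-sym (path-arc⇒≢ iu))
              (λ { refl → m+1+n≢n 1 (sym j≡) }) (λ y yj → path-inNeighbour-unique yj uj)

  preceded×followed⇒isods : Preceded (χ S) → Followed (χ S) n → ISODS (PathDigraph n) S
  preceded×followed⇒isods preceded followed = dom , secure
    where
    dom : OutDominating (PathDigraph n) S
    dom = preceded⇒outDominating preceded

    secure : ∀ v → v ∉ S → ∃[ u ] (Arc (PathDigraph n) v u × u ∈ S × OutDominating (PathDigraph n) (swap S u v))
    secure v v∉S with followed (toℕ v) (∉⇒χ≡false S v∉S)
    ... | v⁺<n , χv⁺ , χv⁺⁺ = u , vu , χ≡true⇒∈ S u (subst (λ k → χ S k ≡ true) vu χv⁺) ,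
                              swap-outDominating (PathDigraph n) dom vu u⁺⊆S
      where
      u : Fin n
      u = fromℕ< v⁺<n
      vu : Arc (PathDigraph n) v u
      vu = sym (toℕ-fromℕ< v⁺<n)
      u⁺⊆S : ∀ x → Arc (PathDigraph n) u x → x ∈ S
      u⁺⊆S x ux = χ≡true⇒∈ S x (subst (λ k → χ S k ≡ true) (trans (cong suc vu) ux) χv⁺⁺)

data Tiling : Subset n → Set where
  [] : Tiling []
  ●∷_ : {S : Subset n} → Tiling S → Tiling (true ∷ S)
  ●○●∷_ : {S : Subset n} → Tiling S → Tiling (true ∷ false ∷ true ∷ S)

followed-suc : ∀ {f} → Followed f (suc n) → Followed (f ∘ suc) n
followed-suc followed v χv with followed (suc v) χv
... | v⁺<n , χv⁺ , χv⁺⁺ = ≤-pred v⁺<n , χv⁺ , χv⁺⁺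

preceded×followed⇒tiling : ∀ (S : Subset n) → Preceded (χ S) → Followed (χ S) n → Tiling S
preceded×followed⇒tiling [] _ _ = []
preceded×followed⇒tiling (false ∷ S) (() , _) _
preceded×followed⇒tiling (true ∷ []) _ _ = ●∷ []
preceded×followed⇒tiling (true ∷ true ∷ S) (_ , rest) followed =
  ●∷ preceded×followed⇒tiling (true ∷ S) (refl , rest ∘ suc) (followed-suc followed)
preceded×followed⇒tiling (true ∷ false ∷ []) _ followed with followed 1 refl
... | s≤s (s≤s ()) , _
preceded×followed⇒tiling (true ∷ false ∷ false ∷ S) _ followed with followed 1 refl
... | _ , () , _
preceded×followed⇒tiling (true ∷ false ∷ true ∷ S) (_ , rest) followed =
  ●○●∷ preceded×followed⇒tiling S (proj₂ (proj₂ (followed 1 refl)) , λ w → rest (3 + w))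
                                    (followed-suc (followed-suc (followed-suc followed)))

tiling⇒preceded : {S : Subset n} → Tiling S → Preceded (χ S)
tiling⇒preceded [] = refl , λ _ ()
tiling⇒preceded {S = S} (●∷ t) = refl , rest
  where
  rest : ∀ w → χ S (suc w) ≡ false → χ S w ≡ true
  rest zero _ = refl
  rest (suc w) = proj₂ (tiling⇒preceded t) w
tiling⇒preceded {S = S} (●○●∷ t) = refl , rest
  where
  rest : ∀ w → χ S (suc w) ≡ false → χ S w ≡ true
  rest 0 _ = refl
  rest 1 ()
  rest 2 _ = refl
  rest (suc (suc (suc w))) = proj₂ (tiling⇒preceded t) w

tiling⇒followed : {S : Subset n} → Tiling S → Followed (χ S) n
tiling⇒followed [] _ ()
tiling⇒followed (●∷ t) (suc v) χv with tiling⇒followed t v χv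
... | v⁺<n , χv⁺ , χv⁺⁺ = s≤s v⁺<n , χv⁺ , χv⁺⁺
tiling⇒followed (●○●∷ t) 1 _ = s≤s (s≤s (s≤s z≤n)) , refl , proj₁ (tiling⇒preceded t)
tiling⇒followed (●○●∷ t) (suc (suc (suc v))) χv with tiling⇒followed t v χv
... | v⁺<n , χv⁺ , χv⁺⁺ = s≤s (s≤s (s≤s v⁺<n)) , χv⁺ , χv⁺⁺

isods⇒tiling : ∀ (S : Subset n) → ISODS (PathDigraph n) S → Tiling S
isods⇒tiling S isods@(dom , _) =
  preceded×followed⇒tiling S (outDominating⇒preceded dom) (isods⇒followed isods)

tiling⇒isods : {S : Subset n} → Tiling S → ISODS (PathDigraph n) S
tiling⇒isods t = preceded×followed⇒isods (tiling⇒preceded t) (tiling⇒followed t)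

tiling⇒2n≤3∣S∣ : {S : Subset n} → Tiling S → 2 * n ≤ 3 * ∣ S ∣
tiling⇒2n≤3∣S∣ [] = z≤n
tiling⇒2n≤3∣S∣ {suc n} {S = true ∷ S} (●∷ t) = begin
  2 * (1 + n)     ≡⟨ *-distribˡ-+ 2 1 n ⟩
  2 + 2 * n       ≤⟨ +-mono-≤ (n≤1+n 2) (tiling⇒2n≤3∣S∣ t) ⟩
  3 + 3 * ∣ S ∣   ≡⟨ *-distribˡ-+ 3 1 ∣ S ∣ ⟨
  3 * (1 + ∣ S ∣) ∎
  where open ≤-Reasoning
tiling⇒2n≤3∣S∣ {suc (suc (suc n))} {S = true ∷ false ∷ true ∷ S} (●○●∷ t) = begin
  2 * (3 + n)     ≡⟨ *-distribˡ-+ 2 3 n ⟩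
  6 + 2 * n       ≤⟨ +-monoʳ-≤ 6 (tiling⇒2n≤3∣S∣ t) ⟩
  6 + 3 * ∣ S ∣   ≡⟨ *-distribˡ-+ 3 2 ∣ S ∣ ⟨
  3 * (2 + ∣ S ∣) ∎
  where open ≤-Reasoning

ceil2n/3-least : ∀ n t → 2 * n ≤ 3 * t → ceil2n/3 n ≤ t
ceil2n/3-least n t 2n≤3t = ≤-pred (m<n*o⇒m/o<n (begin-strict
  2 * n + 2   ≤⟨ +-monoˡ-≤ 2 2n≤3t ⟩
  3 * t + 2   <⟨ ≤-reflexive (lemma t) ⟩
  suc t * 3   ∎))
  where
  open ≤-Reasoning
  lemma : ∀ t → suc (3 * t + 2) ≡ suc t * 3
  lemma = solve-∀

ceil2n/3-3+ : ∀ k → ceil2n/3 (3 + k) ≡ 2 + ceil2n/3 k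
ceil2n/3-3+ k = begin
  (2 * (3 + k) + 2) / 3     ≡⟨ cong (_/ 3) (lemma k) ⟩
  (2 * k + 2 + 6) / 3       ≡⟨ +-distrib-/-∣ʳ (2 * k + 2) (divides-refl 2) ⟩
  ceil2n/3 k + 2            ≡⟨ +-comm (ceil2n/3 k) 2 ⟩
  2 + ceil2n/3 k            ∎
  where
  open ≡-Reasoning
  lemma : ∀ k → 2 * (3 + k) + 2 ≡ 2 * k + 2 + 6
  lemma = solve-∀

optimal : (n : ℕ) → Subset n
optimal 0 = []
optimal 1 = true ∷ []
optimal 2 = true ∷ true ∷ []
optimal (suc (suc (suc k))) = true ∷ false ∷ true ∷ optimal k

optimal-tiling : ∀ n → Tiling (optimal n)
optimal-tiling 0 = []
optimal-tiling 1 = ●∷ []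
optimal-tiling 2 = ●∷ ●∷ []
optimal-tiling (suc (suc (suc k))) = ●○●∷ optimal-tiling k

∣optimal∣ : ∀ n → ∣ optimal n ∣ ≡ ceil2n/3 n
∣optimal∣ 0 = refl
∣optimal∣ 1 = refl
∣optimal∣ 2 = refl
∣optimal∣ (suc (suc (suc k))) = trans (cong (2 +_) (∣optimal∣ k)) (sym (ceil2n/3-3+ k))

proposition5p8 : (n : ℕ) → 1 ≤ n → IsγIso (PathDigraph n) (ceil2n/3 n)
proposition5p8 n _ =
  (optimal n , tiling⇒isods (optimal-tiling n) , ∣optimal∣ n) ,
  λ S isods → ceil2n/3-least n ∣ S ∣ (tiling⇒2n≤3∣S∣ (isods⇒tiling S isods))
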